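{- Let $D$ be a weak prime domain and $i,i',i''\in\mathrm{Ir}(D)$ such that $i\leftrightarrow i'$, $i\leftrightarrow i''$, and $i',i''$ are consistent. Then $i'\leftrightarrow i''$.
   Context: Consistent: has an upper bound; pairwise consistent: every two elements have an upper bound. A domain is a partial order in which pairwise consistent subsets have joins, every element is the join of the compact elements below it (compact: $d\sqsubseteq\bigsqcup X$ for directed $X$ implies $d\sqsubseteq x$ for some $x\in X$), and each compact has finitely many elements below it. $\mathrm{Ir}(D)$: irreducibles, i.e. compacts $i$ such that $i=\bigsqcup X$ for a pairwise consistent set $X$ of compacts implies $i\in X$. For $i,i'\in\mathrm{Ir}(D)$, $i\leftrightarrow i'$ iff for all $X\subseteq\mathrm{Ir}(D)$ with $X\cup\{i\}$, $X\cup\{i'\}$ downward closed and consistent, $\bigsqcup(X\cup\{i\})=\bigsqcup(X\cup\{i'\})$, and for some such $X$, $\bigsqcup X\neq\bigsqcup(X\cup\{i\})$. A weak prime is an $i\in\mathrm{Ir}(D)$ such that for consistent $X\subseteq D$ with $i\sqsubseteq\bigsqcup X$ there are $i'\in\mathrm{Ir}(D)$ with $i\leftrightarrow i'$ and $d\in X$ with $i'\sqsubseteq d$. A weak prime domain is a domain in which every element is the join of the weak primes below it. -}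

module Defs where

open import Level using (Level; _⊔_; suc)
open import Relation.Binary.Bundles using (Poset)
open import Relation.Unary using (Pred)
open import Relation.Nullary using (¬_)
open import Data.Product using (Σ; ∃; _×_; _,_)
open import Data.Sum using (_⊎_)
open import Data.List using (List)
open import Data.List.Relation.Unary.Any using (Any)

-- Order-theoretic notions over a poset (with setoid equality _≈_).
-- Subsets that the axioms quantify over are predicates of level
-- c ⊔ ℓ₁ ⊔ ℓ₂ (enough to contain singletons, unions, etc.).
module DomainTheory {c ℓ₁ ℓ₂ : Level} (P : Poset c ℓ₁ ℓ₂) where
  open Poset P renaming (Carrier to D; _≤_ to _⊑_) public

  ℓS : Level
  ℓS = c ⊔ ℓ₁ ⊔ ℓ₂

  Subset : Set (suc ℓS)
  Subset = Pred D ℓS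

  UpperBound : ∀ {r} → Pred D r → D → Set (c ⊔ r ⊔ ℓ₂)
  UpperBound X a = ∀ x → X x → x ⊑ a

  IsLub : ∀ {r} → Pred D r → D → Set (c ⊔ r ⊔ ℓ₂)
  IsLub X a = UpperBound X a × (∀ b → UpperBound X b → a ⊑ b)

  Consistent : ∀ {r} → Pred D r → Set (c ⊔ r ⊔ ℓ₂)
  Consistent X = ∃ λ a → UpperBound X a

  PairwiseConsistent : ∀ {r} → Pred D r → Set (c ⊔ r ⊔ ℓ₂)
  PairwiseConsistent X = ∀ x y → X x → X y → ∃ λ u → x ⊑ u × y ⊑ u

  Directed : ∀ {r} → Pred D r → Set (c ⊔ r ⊔ ℓ₂)
  Directed X = (∃ λ x → X x)
             × (∀ x y → X x → X y → ∃ λ u → X u × x ⊑ u × y ⊑ u)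

  Compact : D → Set (suc ℓS)
  Compact d = (X : Subset) → Directed X → ∀ a → IsLub X a → d ⊑ a →
              ∃ λ x → X x × d ⊑ x

  FinitelyManyBelow : D → Set (c ⊔ ℓ₁ ⊔ ℓ₂)
  FinitelyManyBelow d = ∃ λ (xs : List D) → ∀ y → y ⊑ d → Any (y ≈_) xs

  _∪｛_｝ : Subset → D → Subset
  (X ∪｛ i ｝) x = X x ⊎ Lift′ (x ≈ i)
    where
      Lift′ : Set ℓ₁ → Set ℓS
      Lift′ A = Level.Lift ℓS A

  record IsDomain : Set (suc ℓS) where
    field
      joins      : (X : Subset) → PairwiseConsistent X → ∃ λ a → IsLub X a
      algebraic  : ∀ x → IsLub (λ d → Compact d × d ⊑ x) x
      finiteBelow : ∀ d → Compact d → FinitelyManyBelow d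

  Irreducible : D → Set (suc ℓS)
  Irreducible i = Compact i ×
    ((X : Subset) → (∀ x → X x → Compact x) → PairwiseConsistent X →
     IsLub X i → ∃ λ x → X x × x ≈ i)

  DownClosedIr : Subset → Set (suc ℓS)
  DownClosedIr Y = ∀ j y → Irreducible j → Y y → j ⊑ y → Y j

  Admissible : D → D → Subset → Set (suc ℓS)
  Admissible i i′ X = (∀ x → X x → Irreducible x)
                    × DownClosedIr (X ∪｛ i ｝) × DownClosedIr (X ∪｛ i′ ｝)
                    × Consistent (X ∪｛ i ｝) × Consistent (X ∪｛ i′ ｝)

  _↔_ : D → D → Set (suc ℓS)
  i ↔ i′ =
    ((X : Subset) → Admissible i i′ X →
       ∀ a b → IsLub (X ∪｛ i ｝) a → IsLub (X ∪｛ i′ ｝) b → a ≈ b)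
    × (∃ λ (X : Subset) → Admissible i i′ X ×
         ∃ λ a → ∃ λ b → IsLub X a × IsLub (X ∪｛ i ｝) b × ¬ (a ≈ b))

  WeakPrime : D → Set (suc ℓS)
  WeakPrime i = Irreducible i ×
    ((X : Subset) → Consistent X → ∀ a → IsLub X a → i ⊑ a →
     ∃ λ i′ → Irreducible i′ × (i ↔ i′) × ∃ λ d → X d × i′ ⊑ d)

  record IsWeakPrimeDomain : Set (suc ℓS) where
    field
      isDomain  : IsDomain
      weakPrimeAlgebraic : ∀ x → IsLub (λ w → WeakPrime w × w ⊑ x) x

-- Choose separating sets X₁ for i ↔ i′ and X₂ for i ↔ i″: admissible sets
-- whose join lies below neither member of the pair.  The irreducibles lying
-- in X₁ ∩ X₂ below i, in X₁ below i′, or in X₂ below i″ form a set T that is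
-- admissible for all three pairs (i,i′), (i,i″), (i′,i″); hence the joins of
-- T ∪ {i′} and T ∪ {i″} coincide.  As every element is the join of the weak
-- primes below it, comparing the joins of X ∪ {i′} and X ∪ {i″} reduces to
-- the case where i″ is a weak prime.  Weak primality, applied to i″ below the
-- join of T ∪ {i′}, yields a partner j ↔ i″ below some element of T ∪ {i′};
-- it cannot lie below an element of X₂, so j ⊑ i′, and then X ∪ {i′} is
-- admissible for (i″, j), which puts i″ below the join of X ∪ {i′}.  The same
-- set T separates i′ from i″.

module Submission where

open import Defs
open import Level using (Level; _⊔_; Lift; lift)
open import Relation.Binary.Bundles using (Poset)
open import Data.Product using (∃; _×_; _,_; proj₁; proj₂)
open import Data.Sum using (_⊎_; inj₁; inj₂)
open import Data.Empty using (⊥; ⊥-elim)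
open import Relation.Nullary using (¬_)
open import Relation.Unary using (Pred; _⊆_; _≐_)
open import Relation.Unary.Properties using (≐-sym)

module OrderFacts {c ℓ₁ ℓ₂ : Level} (P : Poset c ℓ₁ ℓ₂) where
  open DomainTheory P

  Compatible : D → D → Set (c ⊔ ℓ₂)
  Compatible x y = ∃ λ u → x ⊑ u × y ⊑ u

  compatible-sym : ∀ {x y} → Compatible x y → Compatible y x
  compatible-sym (u , x⊑u , y⊑u) = u , y⊑u , x⊑u

  ∪-self : ∀ {A : Set ℓS} {i} → A ⊎ Lift ℓS (i ≈ i)
  ∪-self = inj₂ (lift Eq.refl)

  ∪-≐ : ∀ {X : Subset} {i k} → i ≈ k → (X ∪｛ i ｝) ≐ (X ∪｛ k ｝)
  ∪-≐ {X} {i} {k} i≈k = to i≈k , to (Eq.sym i≈k)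
    where
    to : ∀ {i k} → i ≈ k → (X ∪｛ i ｝) ⊆ (X ∪｛ k ｝)
    to _ (inj₁ x∈X) = inj₁ x∈X
    to i≈k (inj₂ (lift x≈i)) = inj₂ (lift (Eq.trans x≈i i≈k))

  isLub-unique : ∀ {r} {S : Pred D r} {a b} → IsLub S a → IsLub S b → a ≈ b
  isLub-unique (a-ub , a-least) (b-ub , b-least) = antisym (a-least _ b-ub) (b-least _ a-ub)

  isLub-resp-≈ : ∀ {r} {S : Pred D r} {a b} → a ≈ b → IsLub S a → IsLub S b
  isLub-resp-≈ a≈b (a-ub , a-least) =
    (λ x x∈S → trans (a-ub x x∈S) (reflexive a≈b)) ,
    (λ b′ b′-ub → trans (reflexive (Eq.sym a≈b)) (a-least b′ b′-ub))

  isLub-resp-≐ : ∀ {S S′ : Subset} {a} → S ≐ S′ → IsLub S a → IsLub S′ a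
  isLub-resp-≐ (S⊆S′ , S′⊆S) (a-ub , a-least) =
    (λ x x∈S′ → a-ub x (S′⊆S x∈S′)) , (λ b b-ub → a-least b (λ x x∈S → b-ub x (S⊆S′ x∈S)))

  isLub⇒consistent : ∀ {r} {S : Pred D r} {a} → IsLub S a → Consistent S
  isLub⇒consistent (a-ub , _) = _ , a-ub

  isLub-∪⇒upperBound : ∀ {X : Subset} {y a} → IsLub (X ∪｛ y ｝) a → UpperBound X a
  isLub-∪⇒upperBound (a-ub , _) x x∈X = a-ub x (inj₁ x∈X)

  isLub-∪-least : ∀ {X : Subset} {y a b} →
    IsLub (X ∪｛ y ｝) a → UpperBound X b → y ⊑ b → a ⊑ b
  isLub-∪-least (_ , a-least) X⊑b y⊑b = a-least _ λ where
    x (inj₁ x∈X) → X⊑b x x∈X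
    x (inj₂ (lift x≈y)) → trans (reflexive x≈y) y⊑b

  isLub-∪-below : ∀ {X : Subset} {w y} → IsLub X w → y ⊑ w → IsLub (X ∪｛ y ｝) w
  isLub-∪-below (w-ub , w-least) y⊑w =
    (λ where
      x (inj₁ x∈X) → w-ub x x∈X
      x (inj₂ (lift x≈y)) → trans (reflexive x≈y) y⊑w) ,
    (λ b b-ub → w-least b (λ x x∈X → b-ub x (inj₁ x∈X)))

  consistent-⊆ : ∀ {S S′ : Subset} → S′ ⊆ S → Consistent S → Consistent S′
  consistent-⊆ S′⊆S (a , a-ub) = a , λ x x∈S′ → a-ub x (S′⊆S x∈S′)

  consistent⇒pairwise : ∀ {r} {S : Pred D r} → Consistent S → PairwiseConsistent S
  consistent⇒pairwise (a , a-ub) x y x∈S y∈S = a , a-ub x x∈S , a-ub y y∈S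

  pairwise-∪ : ∀ {T : Subset} {z} → PairwiseConsistent T →
    (∀ {x} → T x → Compatible x z) → PairwiseConsistent (T ∪｛ z ｝)
  pairwise-∪ T-pw _ x y (inj₁ x∈T) (inj₁ y∈T) = T-pw x y x∈T y∈T
  pairwise-∪ _ T-z x y (inj₁ x∈T) (inj₂ (lift y≈z)) =
    let (u , x⊑u , z⊑u) = T-z x∈T in u , x⊑u , trans (reflexive y≈z) z⊑u
  pairwise-∪ _ T-z x y (inj₂ (lift x≈z)) (inj₁ y∈T) =
    let (u , y⊑u , z⊑u) = T-z y∈T in u , trans (reflexive x≈z) z⊑u , y⊑u
  pairwise-∪ {z = z} _ _ x y (inj₂ (lift x≈z)) (inj₂ (lift y≈z)) =
    z , reflexive x≈z , reflexive y≈z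

  downClosed-resp-≐ : ∀ {S S′ : Subset} → S ≐ S′ → DownClosedIr S → DownClosedIr S′
  downClosed-resp-≐ (S⊆S′ , S′⊆S) S-down k y k-irr y∈S′ k⊑y =
    S⊆S′ (S-down k y k-irr (S′⊆S y∈S′) k⊑y)

  downClosed-∪ : ∀ {T : Subset} {z} → DownClosedIr T →
    (∀ k → Irreducible k → k ⊑ z → (T ∪｛ z ｝) k) → DownClosedIr (T ∪｛ z ｝)
  downClosed-∪ T-down _ k y k-irr (inj₁ y∈T) k⊑y = inj₁ (T-down k y k-irr y∈T k⊑y)
  downClosed-∪ _ below-z k y k-irr (inj₂ (lift y≈z)) k⊑y =
    below-z k k-irr (trans k⊑y (reflexive y≈z))

  downClosed-∪-below : ∀ {X : Subset} {d j} → DownClosedIr X → X d → j ⊑ d →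
    DownClosedIr (X ∪｛ j ｝)
  downClosed-∪-below X-down d∈X j⊑d = downClosed-∪ X-down λ k k-irr k⊑j →
    inj₁ (X-down k _ k-irr d∈X (trans k⊑j j⊑d))

  downClosed-∪-∪ : ∀ {X : Subset} {p q} → DownClosedIr (X ∪｛ p ｝) →
    DownClosedIr (X ∪｛ q ｝) → DownClosedIr ((X ∪｛ p ｝) ∪｛ q ｝)
  downClosed-∪-∪ {X} {p} {q} p-down q-down = downClosed-∪ p-down λ k k-irr k⊑q →
    case (q-down k q k-irr ∪-self k⊑q)
    where
    case : ∀ {k} → (X ∪｛ q ｝) k → ((X ∪｛ p ｝) ∪｛ q ｝) k
    case (inj₁ k∈X) = inj₁ (inj₁ k∈X)
    case (inj₂ k≈q) = inj₂ k≈q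

  compact-resp-≈ : ∀ {d d′} → d ≈ d′ → Compact d → Compact d′
  compact-resp-≈ d≈d′ d-compact X X-directed a a-lub d′⊑a =
    let (x , x∈X , d⊑x) = d-compact X X-directed a a-lub (trans (reflexive d≈d′) d′⊑a)
    in x , x∈X , trans (reflexive (Eq.sym d≈d′)) d⊑x

  irreducible-resp-≈ : ∀ {d d′} → d ≈ d′ → Irreducible d → Irreducible d′
  irreducible-resp-≈ d≈d′ (d-compact , d-irr) =
    compact-resp-≈ d≈d′ d-compact , λ X X-compact X-pw d′-lub →
      let (x , x∈X , x≈d) = d-irr X X-compact X-pw (isLub-resp-≈ (Eq.sym d≈d′) d′-lub)
      in x , x∈X , Eq.trans x≈d d≈d′

  admissible-swap : ∀ {X : Subset} {i i′} → Admissible i i′ X → Admissible i′ i X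
  admissible-swap (irr , down , down′ , cons , cons′) = irr , down′ , down , cons′ , cons

  admissible-respˡ : ∀ {X : Subset} {i k i′} → i ≈ k → Admissible i i′ X → Admissible k i′ X
  admissible-respˡ {X} i≈k (irr , down , down′ , cons , cons′) =
    irr , downClosed-resp-≐ (∪-≐ {X} i≈k) down , down′ ,
    consistent-⊆ (proj₂ (∪-≐ {X} i≈k)) cons , cons′

  ↔-respˡ : ∀ {i k i′} → i ≈ k → i ↔ i′ → k ↔ i′
  ↔-respˡ i≈k (agree , X , adm , a , b , a-lub , b-lub , a≉b) =
    (λ X′ adm′ a′ b′ a′-lub b′-lub →
       agree X′ (admissible-respˡ (Eq.sym i≈k) adm′) a′ b′
             (isLub-resp-≐ (≐-sym (∪-≐ i≈k)) a′-lub) b′-lub) ,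
    X , admissible-respˡ i≈k adm , a , b , a-lub , isLub-resp-≐ (∪-≐ i≈k) b-lub , a≉b

  weakPrime-resp-≈ : ∀ {w q} → w ≈ q → WeakPrime w → WeakPrime q
  weakPrime-resp-≈ w≈q (w-irr , w-prime) =
    irreducible-resp-≈ w≈q w-irr , λ X X-cons a a-lub q⊑a →
      let (j , j-irr , w↔j , below) = w-prime X X-cons a a-lub (trans (reflexive w≈q) q⊑a)
      in j , j-irr , ↔-respˡ w≈q w↔j , below

  -- The second clause of x ↔ y, with ⊔X ≉ ⊔(X ∪ {x}) restated as: neither x nor y is below ⊔X.
  record Separation (x y : D) : Set (Level.suc ℓS) where
    field
      X : Subset
      irreducible : ∀ z → X z → Irreducible z
      downClosedˡ : DownClosedIr (X ∪｛ x ｝)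
      downClosedʳ : DownClosedIr (X ∪｛ y ｝)
      consistentˡ : Consistent (X ∪｛ x ｝)
      consistentʳ : Consistent (X ∪｛ y ｝)
      ⊔X : D
      ⊔X-isLub : IsLub X ⊔X
      x⋢⊔X : ¬ x ⊑ ⊔X
      y⋢⊔X : ¬ y ⊑ ⊔X

    downClosed : DownClosedIr X
    downClosed k z k-irr z∈X k⊑z with downClosedˡ k z k-irr (inj₁ z∈X) k⊑z
    ... | inj₁ k∈X = k∈X
    ... | inj₂ (lift k≈x) =
      ⊥-elim (x⋢⊔X (trans (reflexive (Eq.sym k≈x)) (trans k⊑z (proj₁ ⊔X-isLub z z∈X))))

    ∪-below-isLub : ∀ {d j} → X d → j ⊑ d → IsLub (X ∪｛ j ｝) ⊔X
    ∪-below-isLub d∈X j⊑d = isLub-∪-below ⊔X-isLub (trans j⊑d (proj₁ ⊔X-isLub _ d∈X))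

  separation : ∀ {x y} → x ↔ y → Separation x y
  separation (agree , X , adm@(irr , downˡ , downʳ , consˡ , consʳ) , a , b , a-lub , b-lub , a≉b) =
    record
      { X = X ; irreducible = irr
      ; downClosedˡ = downˡ ; downClosedʳ = downʳ
      ; consistentˡ = consˡ ; consistentʳ = consʳ
      ; ⊔X = a ; ⊔X-isLub = a-lub
      ; x⋢⊔X = λ x⊑a → a≉b (isLub-unique (isLub-∪-below a-lub x⊑a) b-lub)
      ; y⋢⊔X = λ y⊑a → a≉b (Eq.sym (agree X adm b a b-lub (isLub-∪-below a-lub y⊑a)))
      }

module WeakPrimeDomainFacts {c ℓ₁ ℓ₂ : Level} (P : Poset c ℓ₁ ℓ₂)
  (W : DomainTheory.IsWeakPrimeDomain P) where
  open DomainTheory P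
  open OrderFacts P
  open IsWeakPrimeDomain W
  open IsDomain isDomain

  join : ∀ {S : Subset} → Consistent S → ∃ (IsLub S)
  join {S} S-cons = joins S (consistent⇒pairwise S-cons)

  ↔-sym : ∀ {i i′} → i ↔ i′ → i′ ↔ i
  ↔-sym (agree , X , adm@(_ , _ , _ , _ , consʳ) , a , b , a-lub , b-lub , a≉b) =
    (λ X′ adm′ a′ b′ a′-lub b′-lub →
       Eq.sym (agree X′ (admissible-swap adm′) b′ a′ b′-lub a′-lub)) ,
    X , admissible-swap adm , a , proj₁ ⊔ʳ , a-lub , proj₂ ⊔ʳ ,
    (λ a≈⊔ʳ → a≉b (Eq.trans a≈⊔ʳ (Eq.sym (agree X adm b _ b-lub (proj₂ ⊔ʳ)))))
    where
    ⊔ʳ = join consʳ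

  -- q is the join of the weak primes below it, and all of them but q itself lie in X.
  ⊑-by-weakPrimes : ∀ {X : Subset} {q a} → DownClosedIr (X ∪｛ q ｝) → UpperBound X a →
    (WeakPrime q → q ⊑ a) → q ⊑ a
  ⊑-by-weakPrimes {X} {q} {a} down X⊑a prime⇒⊑ = proj₂ (weakPrimeAlgebraic q) a bound
    where
    bound : UpperBound (λ w → WeakPrime w × w ⊑ q) a
    bound w (w-prime , w⊑q) with down w q (proj₁ w-prime) ∪-self w⊑q
    ... | inj₁ w∈X = X⊑a w w∈X
    ... | inj₂ (lift w≈q) = trans (reflexive w≈q) (prime⇒⊑ (weakPrime-resp-≈ w≈q w-prime))

  separation-excludes-partnerʳ : ∀ {x y j d} (s : Separation x y) → y ↔ j →
    Separation.X s d → j ⊑ d → ⊥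
  separation-excludes-partnerʳ {y = y} {j} s y↔j d∈X j⊑d =
    y⋢⊔X (trans (proj₁ (proj₂ ⊔y) y ∪-self)
                (reflexive (proj₁ y↔j X adm (proj₁ ⊔y) ⊔X (proj₂ ⊔y) ⊔j-isLub)))
    where
    open Separation s
    ⊔y = join consistentʳ
    ⊔j-isLub = ∪-below-isLub d∈X j⊑d
    adm : Admissible y j X
    adm = irreducible , downClosedʳ , downClosed-∪-below downClosed d∈X j⊑d ,
          consistentʳ , isLub⇒consistent ⊔j-isLub

  ↔-partner-below-⊑ : ∀ {X : Subset} {p q j a} → Irreducible p → Compatible p q →
    Admissible p q X → q ↔ j → j ⊑ p → IsLub (X ∪｛ p ｝) a → q ⊑ a
  ↔-partner-below-⊑ {X} {p} {q} {j} {a} p-irr pq (irr , p-down , q-down , p-cons , q-cons)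
                    q↔j j⊑p a-lub =
    trans (proj₁ (proj₂ ⊔q) q ∪-self) (reflexive (proj₁ q↔j (X ∪｛ p ｝) adm _ a (proj₂ ⊔q) ⊔j-isLub))
    where
    ⊔j-isLub : IsLub ((X ∪｛ p ｝) ∪｛ j ｝) a
    ⊔j-isLub = isLub-∪-below a-lub (trans j⊑p (proj₁ a-lub p ∪-self))
    compatible-q : ∀ {x} → (X ∪｛ p ｝) x → Compatible x q
    compatible-q (inj₁ x∈X) = consistent⇒pairwise q-cons _ _ (inj₁ x∈X) ∪-self
    compatible-q (inj₂ (lift x≈p)) =
      let (u , p⊑u , q⊑u) = pq in u , trans (reflexive x≈p) p⊑u , q⊑u
    ⊔q = joins _ (pairwise-∪ (consistent⇒pairwise p-cons) compatible-q)
    irr′ : ∀ x → (X ∪｛ p ｝) x → Irreducible x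
    irr′ x (inj₁ x∈X) = irr x x∈X
    irr′ x (inj₂ (lift x≈p)) = irreducible-resp-≈ (Eq.sym x≈p) p-irr
    adm : Admissible q j (X ∪｛ p ｝)
    adm = irr′ , downClosed-∪-∪ p-down q-down , downClosed-∪-below p-down ∪-self j⊑p ,
          isLub⇒consistent (proj₂ ⊔q) , isLub⇒consistent ⊔j-isLub

  module Refinement {c p q} (s₁ : Separation c p) (s₂ : Separation c q) (pq : Compatible p q) where
    private
      module S₁ = Separation s₁
      module S₂ = Separation s₂

    data T (y : D) : Set ℓS where
      common : S₁.X y → S₂.X y → y ⊑ c → T y
      left   : S₁.X y → y ⊑ p → T y
      right  : S₂.X y → y ⊑ q → T y

    irreducible : ∀ y → T y → Irreducible y
    irreducible y (common y∈X₁ _ _) = S₁.irreducible y y∈X₁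
    irreducible y (left y∈X₁ _) = S₁.irreducible y y∈X₁
    irreducible y (right y∈X₂ _) = S₂.irreducible y y∈X₂

    downClosed : DownClosedIr T
    downClosed k y k-irr (common y∈X₁ y∈X₂ y⊑c) k⊑y =
      common (S₁.downClosed k y k-irr y∈X₁ k⊑y) (S₂.downClosed k y k-irr y∈X₂ k⊑y) (trans k⊑y y⊑c)
    downClosed k y k-irr (left y∈X₁ y⊑p) k⊑y = left (S₁.downClosed k y k-irr y∈X₁ k⊑y) (trans k⊑y y⊑p)
    downClosed k y k-irr (right y∈X₂ y⊑q) k⊑y = right (S₂.downClosed k y k-irr y∈X₂ k⊑y) (trans k⊑y y⊑q)

    downClosedᶜ : DownClosedIr (T ∪｛ c ｝)
    downClosedᶜ = downClosed-∪ downClosed below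
      where
      below : ∀ k → Irreducible k → k ⊑ c → (T ∪｛ c ｝) k
      below k k-irr k⊑c with S₁.downClosedˡ k c k-irr ∪-self k⊑c | S₂.downClosedˡ k c k-irr ∪-self k⊑c
      ... | inj₁ k∈X₁ | inj₁ k∈X₂ = inj₁ (common k∈X₁ k∈X₂ k⊑c)
      ... | inj₂ k≈c  | _         = inj₂ k≈c
      ... | inj₁ _    | inj₂ k≈c  = inj₂ k≈c

    downClosedᵖ : DownClosedIr (T ∪｛ p ｝)
    downClosedᵖ = downClosed-∪ downClosed below
      where
      below : ∀ k → Irreducible k → k ⊑ p → (T ∪｛ p ｝) k
      below k k-irr k⊑p with S₁.downClosedʳ k p k-irr ∪-self k⊑p
      ... | inj₁ k∈X₁ = inj₁ (left k∈X₁ k⊑p)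
      ... | inj₂ k≈p  = inj₂ k≈p

    downClosedᑫ : DownClosedIr (T ∪｛ q ｝)
    downClosedᑫ = downClosed-∪ downClosed below
      where
      below : ∀ k → Irreducible k → k ⊑ q → (T ∪｛ q ｝) k
      below k k-irr k⊑q with S₂.downClosedʳ k q k-irr ∪-self k⊑q
      ... | inj₁ k∈X₂ = inj₁ (right k∈X₂ k⊑q)
      ... | inj₂ k≈q  = inj₂ k≈q

    private
      u = proj₁ pq
      p⊑u = proj₁ (proj₂ pq)
      q⊑u = proj₂ (proj₂ pq)

      compatible-in-X₁ : ∀ {x y} → S₁.X x → S₁.X y → Compatible x y
      compatible-in-X₁ x∈X₁ y∈X₁ = consistent⇒pairwise S₁.consistentˡ _ _ (inj₁ x∈X₁) (inj₁ y∈X₁)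

      compatible-in-X₂ : ∀ {x y} → S₂.X x → S₂.X y → Compatible x y
      compatible-in-X₂ x∈X₂ y∈X₂ = consistent⇒pairwise S₂.consistentˡ _ _ (inj₁ x∈X₂) (inj₁ y∈X₂)

    pairwise : PairwiseConsistent T
    pairwise x y (common _ _ x⊑c) (common _ _ y⊑c) = c , x⊑c , y⊑c
    pairwise x y (common x∈X₁ _ _) (left y∈X₁ _) = compatible-in-X₁ x∈X₁ y∈X₁
    pairwise x y (common _ x∈X₂ _) (right y∈X₂ _) = compatible-in-X₂ x∈X₂ y∈X₂
    pairwise x y (left x∈X₁ _) (common y∈X₁ _ _) = compatible-in-X₁ x∈X₁ y∈X₁
    pairwise x y (left _ x⊑p) (left _ y⊑p) = p , x⊑p , y⊑p
    pairwise x y (left _ x⊑p) (right _ y⊑q) = u , trans x⊑p p⊑u , trans y⊑q q⊑u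
    pairwise x y (right x∈X₂ _) (common _ y∈X₂ _) = compatible-in-X₂ x∈X₂ y∈X₂
    pairwise x y (right _ x⊑q) (left _ y⊑p) = u , trans x⊑q q⊑u , trans y⊑p p⊑u
    pairwise x y (right _ x⊑q) (right _ y⊑q) = q , x⊑q , y⊑q

    private
      compatibleᶜ : ∀ {x} → T x → Compatible x c
      compatibleᶜ (common _ _ x⊑c) = c , x⊑c , refl
      compatibleᶜ (left x∈X₁ _) = consistent⇒pairwise S₁.consistentˡ _ _ (inj₁ x∈X₁) ∪-self
      compatibleᶜ (right x∈X₂ _) = consistent⇒pairwise S₂.consistentˡ _ _ (inj₁ x∈X₂) ∪-self

      compatibleᵖ : ∀ {x} → T x → Compatible x p
      compatibleᵖ (common x∈X₁ _ _) = consistent⇒pairwise S₁.consistentʳ _ _ (inj₁ x∈X₁) ∪-self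
      compatibleᵖ (left _ x⊑p) = p , x⊑p , refl
      compatibleᵖ (right _ x⊑q) = u , trans x⊑q q⊑u , p⊑u

      compatibleᑫ : ∀ {x} → T x → Compatible x q
      compatibleᑫ (common _ x∈X₂ _) = consistent⇒pairwise S₂.consistentʳ _ _ (inj₁ x∈X₂) ∪-self
      compatibleᑫ (left _ x⊑p) = u , trans x⊑p p⊑u , q⊑u
      compatibleᑫ (right _ x⊑q) = q , x⊑q , refl

    ⊔ᶜ : ∃ (IsLub (T ∪｛ c ｝))
    ⊔ᶜ = joins _ (pairwise-∪ pairwise compatibleᶜ)

    ⊔ᵖ : ∃ (IsLub (T ∪｛ p ｝))
    ⊔ᵖ = joins _ (pairwise-∪ pairwise compatibleᵖ)

    ⊔ᑫ : ∃ (IsLub (T ∪｛ q ｝))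
    ⊔ᑫ = joins _ (pairwise-∪ pairwise compatibleᑫ)

    admissibleᶜᵖ : Admissible c p T
    admissibleᶜᵖ = irreducible , downClosedᶜ , downClosedᵖ ,
                   isLub⇒consistent (proj₂ ⊔ᶜ) , isLub⇒consistent (proj₂ ⊔ᵖ)

    admissibleᶜᑫ : Admissible c q T
    admissibleᶜᑫ = irreducible , downClosedᶜ , downClosedᑫ ,
                   isLub⇒consistent (proj₂ ⊔ᶜ) , isLub⇒consistent (proj₂ ⊔ᑫ)

    admissibleᵖᑫ : Admissible p q T
    admissibleᵖᑫ = irreducible , downClosedᵖ , downClosedᑫ ,
                   isLub⇒consistent (proj₂ ⊔ᵖ) , isLub⇒consistent (proj₂ ⊔ᑫ)

  common-partner-⊑ : ∀ {c p q} {X : Subset} {a} → c ↔ p → c ↔ q → Irreducible p →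
    Compatible p q → Admissible p q X → IsLub (X ∪｛ p ｝) a → q ⊑ a
  common-partner-⊑ {p = p} {q} {a = a} c↔p c↔q p-irr pq adm a-lub =
    ⊑-by-weakPrimes (proj₁ (proj₂ (proj₂ adm))) (isLub-∪⇒upperBound a-lub) weakPrime⇒⊑
    where
    s₂ = separation c↔q
    open Refinement (separation c↔p) s₂ pq

    q⊑⊔ᵖ : q ⊑ proj₁ ⊔ᵖ
    q⊑⊔ᵖ = trans (proj₁ (proj₂ ⊔ᑫ) q ∪-self) (reflexive (begin
      proj₁ ⊔ᑫ ≈⟨ Eq.sym (proj₁ c↔q T admissibleᶜᑫ _ _ (proj₂ ⊔ᶜ) (proj₂ ⊔ᑫ)) ⟩
      proj₁ ⊔ᶜ ≈⟨ proj₁ c↔p T admissibleᶜᵖ _ _ (proj₂ ⊔ᶜ) (proj₂ ⊔ᵖ) ⟩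
      proj₁ ⊔ᵖ ∎))
      where open import Relation.Binary.Reasoning.Setoid Eq.setoid

    below-p : ∀ {j} → q ↔ j → j ⊑ p → q ⊑ a
    below-p q↔j j⊑p = ↔-partner-below-⊑ p-irr pq adm q↔j j⊑p a-lub

    weakPrime⇒⊑ : WeakPrime q → q ⊑ a
    weakPrime⇒⊑ (_ , q-prime)
      with q-prime (T ∪｛ p ｝) (isLub⇒consistent (proj₂ ⊔ᵖ)) _ (proj₂ ⊔ᵖ) q⊑⊔ᵖ
    ... | _ , _ , q↔j , _ , inj₁ (common _ d∈X₂ _) , j⊑d =
      ⊥-elim (separation-excludes-partnerʳ s₂ q↔j d∈X₂ j⊑d)
    ... | _ , _ , q↔j , _ , inj₁ (right d∈X₂ _) , j⊑d =
      ⊥-elim (separation-excludes-partnerʳ s₂ q↔j d∈X₂ j⊑d)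
    ... | _ , _ , q↔j , _ , inj₁ (left _ d⊑p) , j⊑d = below-p q↔j (trans j⊑d d⊑p)
    ... | _ , _ , q↔j , _ , inj₂ (lift d≈p) , j⊑d = below-p q↔j (trans j⊑d (reflexive d≈p))

  separation-excludes-copartnerˡ : ∀ {x y z j d} (s : Separation x y) → z ↔ j → z ↔ x →
    Irreducible j → Separation.X s d → j ⊑ d → ⊥
  separation-excludes-copartnerˡ {x} {j = j} s z↔j z↔x j-irr d∈X j⊑d =
    x⋢⊔X (common-partner-⊑ z↔j z↔x j-irr jx adm (∪-below-isLub d∈X j⊑d))
    where
    open Separation s
    jx : Compatible j x
    jx = let (b , b-ub) = consistentˡ
         in b , trans j⊑d (b-ub _ (inj₁ d∈X)) , b-ub x ∪-self
    adm : Admissible j x X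
    adm = irreducible , downClosed-∪-below downClosed d∈X j⊑d , downClosedˡ ,
          isLub⇒consistent (∪-below-isLub d∈X j⊑d) , consistentˡ

  ↔-compatible-partners : ∀ {i p q} → i ↔ p → i ↔ q → Irreducible p → Irreducible q →
    Compatible p q → p ↔ q
  ↔-compatible-partners {p = p} {q} i↔p i↔q p-irr q-irr pq = joins-agree , separated
    where
    joins-agree : (X : Subset) → Admissible p q X →
      ∀ a b → IsLub (X ∪｛ p ｝) a → IsLub (X ∪｛ q ｝) b → a ≈ b
    joins-agree X adm a b a-lub b-lub = antisym
      (isLub-∪-least a-lub (isLub-∪⇒upperBound b-lub)
        (common-partner-⊑ i↔q i↔p q-irr (compatible-sym pq) (admissible-swap adm) b-lub))
      (isLub-∪-least b-lub (isLub-∪⇒upperBound a-lub)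
        (common-partner-⊑ i↔p i↔q p-irr pq adm a-lub))

    s₁ = separation i↔p
    s₂ = separation i↔q
    module S₁ = Separation s₁
    open Refinement s₁ s₂ pq

    ⊔T = joins T pairwise

    p-not-weakPrime : WeakPrime p → p ⊑ proj₁ ⊔T → ⊥
    p-not-weakPrime (_ , p-prime) p⊑⊔T with p-prime T (isLub⇒consistent (proj₂ ⊔T)) _ (proj₂ ⊔T) p⊑⊔T
    ... | _ , _ , p↔j , _ , common d∈X₁ _ _ , j⊑d = separation-excludes-partnerʳ s₁ p↔j d∈X₁ j⊑d
    ... | _ , _ , p↔j , _ , left d∈X₁ _ , j⊑d = separation-excludes-partnerʳ s₁ p↔j d∈X₁ j⊑d
    ... | _ , j-irr , p↔j , _ , right d∈X₂ _ , j⊑d =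
      separation-excludes-copartnerˡ s₂ p↔j (↔-sym i↔p) j-irr d∈X₂ j⊑d

    separated : ∃ λ X → Admissible p q X ×
      ∃ λ a → ∃ λ b → IsLub X a × IsLub (X ∪｛ p ｝) b × ¬ (a ≈ b)
    separated = T , admissibleᵖᑫ , _ , _ , proj₂ ⊔T , proj₂ ⊔ᵖ , λ ⊔T≈⊔ᵖ →
      S₁.y⋢⊔X (⊑-by-weakPrimes S₁.downClosedʳ (proj₁ S₁.⊔X-isLub) λ p-prime →
        ⊥-elim (p-not-weakPrime p-prime
          (trans (proj₁ (proj₂ ⊔ᵖ) p ∪-self) (reflexive (Eq.sym ⊔T≈⊔ᵖ)))))

mainTheorem17 : {c ℓ₁ ℓ₂ : Level} (P : Poset c ℓ₁ ℓ₂) →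
    let open DomainTheory P in
    IsWeakPrimeDomain → (i i′ i″ : D) →
    Irreducible i → Irreducible i′ → Irreducible i″ →
    i ↔ i′ → i ↔ i″ → (∃ λ u → i′ ⊑ u × i″ ⊑ u) →
    i′ ↔ i″
mainTheorem17 P W _ _ _ _ i′-irr i″-irr i↔i′ i↔i″ i′i″-compatible =
  WeakPrimeDomainFacts.↔-compatible-partners P W i↔i′ i↔i″ i′-irr i″-irr i′i″-compatible
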